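{- Every logical structure $(\mathscr{L},W)$ with $W$ monotonic and not reflexive is of $s_1$-type.
   Context: A logical structure is a pair $(\mathscr{L},W)$ with $W:\mathcal{P}(\mathscr{L})\to\mathcal{P}(\mathscr{L})$; $W$ is monotonic if $\Gamma\subseteq\Sigma$ implies $W(\Gamma)\subseteq W(\Sigma)$, and reflexive if $\Gamma\subseteq W(\Gamma)$ for all $\Gamma$. For a cardinal $\kappa$, a family $\mathsf{K}\subseteq\mathcal{P}(\mathscr{L})$ is internally $\kappa$ if $|\Gamma|\ge\kappa$ for all $\Gamma\in\mathsf{K}$ and some $\Sigma\in\mathsf{K}$ has $|\Sigma|=\kappa$. $W$ is anti-reflexive$^{\mathsf{K}}_\kappa$ if $\Gamma\cap W(\Gamma)=\emptyset$ for every $\Gamma\in\mathsf{K}$. $(\mathscr{L},W)$ is of $s_\kappa$-type if $W$ is monotonic and anti-reflexive$^{\mathsf{K}}_\kappa$ for some $\mathsf{K}\subseteq\mathcal{P}(\mathscr{L})$ that is internally $\kappa$. -}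

module Defs where

open import Level using (Level; _⊔_) renaming (suc to lsuc)
open import Data.Product using (Σ; ∃; _×_)
open import Relation.Unary using (Pred; _∈_; _⊆_; Empty; _∩_)
open import Function.Bundles using (_↣_; _⤖_)

-- A logical structure (𝓛 , W): a carrier 𝓛 and W : 𝒫(𝓛) → 𝒫(𝓛).
-- Subsets of 𝓛 are predicates 𝓛 → Set a.
Operator : ∀ {a} → Set a → Set (lsuc a)
Operator {a} L = Pred L a → Pred L a

module _ {a : Level} {L : Set a} where

  Elems : Pred L a → Set a
  Elems Γ = Σ L (λ x → x ∈ Γ)

  Monotonic : Operator L → Set (lsuc a)
  Monotonic W = ∀ (Γ Δ : Pred L a) → Γ ⊆ Δ → W Γ ⊆ W Δ

  Reflexive : Operator L → Set (lsuc a)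
  Reflexive W = ∀ (Γ : Pred L a) → Γ ⊆ W Γ

  -- cardinal comparisons against a cardinal κ given by a representative type
  CardGe : Pred L a → Set a → Set a
  CardGe Γ κ = κ ↣ Elems Γ

  CardEq : Pred L a → Set a → Set a
  CardEq Γ κ = κ ⤖ Elems Γ

  InternallyCard : Pred (Pred L a) a → Set a → Set (lsuc a)
  InternallyCard K κ =
    (∀ (Γ : Pred L a) → Γ ∈ K → CardGe Γ κ) × ∃ (λ (Σ′ : Pred L a) → Σ′ ∈ K × CardEq Σ′ κ)

  AntiReflexive : Pred (Pred L a) a → Operator L → Set (lsuc a)
  AntiReflexive K W = ∀ (Γ : Pred L a) → Γ ∈ K → Empty (Γ ∩ W Γ)

  IsSType : Set a → Operator L → Set (lsuc a)
  IsSType κ W = Monotonic W × ∃ (λ (K : Pred (Pred L a) a) → InternallyCard K κ × AntiReflexive K W)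

-- By monotonicity, W is reflexive as soon as x ∈ W {x} for every x;
-- so a non-reflexive W has some x with x ∉ W {x}. Take K to be the family
-- of subsets equal to {x}: it is internally 1, and monotonicity turns
-- x ∉ W {x} into {x} ∩ W {x} = ∅.
module Submission where

open import Defs
open import Level using (Level; Lift; lift)
open import Data.Fin using (Fin; zero)
open import Data.Product using (Σ; _,_; _×_)
open import Relation.Nullary using (¬_)
open import Relation.Unary using (Pred; _∈_; _∉_; _⊆_; ｛_｝)
open import Relation.Binary.PropositionalEquality using (_≡_; refl; subst)
open import Function.Bundles using (mk↣; mk⤖)
open import Function.Definitions using (Surjective)
open import Axiom.ExcludedMiddle using (ExcludedMiddle)
open import Axiom.DoubleNegationElimination using (em⇒dne)

module _ {a : Level} where

  One : Set a
  One = Lift a (Fin 1)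

  One-irrelevant : (i j : One) → i ≡ j
  One-irrelevant (lift zero) (lift zero) = refl

module _ {a : Level} {L : Set a} where

  inhabited⇒CardGe-One : {Γ : Pred L a} {x : L} → x ∈ Γ → CardGe Γ One
  inhabited⇒CardGe-One {x = x} x∈Γ =
    mk↣ {to = λ _ → x , x∈Γ} (λ {i} {j} _ → One-irrelevant i j)

  singleton-CardEq-One : (x : L) → CardEq ｛ x ｝ One
  singleton-CardEq-One x =
    mk⤖ {to = pick} ((λ {i} {j} _ → One-irrelevant i j) , onto)
    where
    pick : One → Elems ｛ x ｝
    pick _ = x , refl
    onto : Surjective _≡_ _≡_ pick
    onto (_ , refl) = lift zero , λ _ → refl

  SingletonsOf : L → Pred (Pred L a) a
  SingletonsOf x Γ = x ∈ Γ × Γ ⊆ ｛ x ｝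

  singletonsOf-internally-One : (x : L) → InternallyCard (SingletonsOf x) One
  singletonsOf-internally-One x =
    (λ _ (x∈Γ , _) → inhabited⇒CardGe-One x∈Γ) ,
    ｛ x ｝ , (refl , λ eq → eq) , singleton-CardEq-One x

  singletonsOf-antiReflexive : {W : Operator L} → Monotonic W →
    {x : L} → x ∉ W ｛ x ｝ → AntiReflexive (SingletonsOf x) W
  singletonsOf-antiReflexive {W} mono {x} x∉W｛x｝ Γ (_ , Γ⊆｛x｝) y (y∈Γ , y∈WΓ) =
    x∉W｛x｝ (subst (W ｛ x ｝) y≡x (mono Γ ｛ x ｝ Γ⊆｛x｝ y∈WΓ))
    where
    y≡x : y ≡ x
    y≡x with Γ⊆｛x｝ y∈Γ
    ... | refl = refl

  reflexive-on-singletons⇒reflexive : {W : Operator L} → Monotonic W →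
    (∀ x → x ∈ W ｛ x ｝) → Reflexive W
  reflexive-on-singletons⇒reflexive mono x∈W｛x｝ Γ {x} x∈Γ =
    mono ｛ x ｝ Γ (λ { refl → x∈Γ }) (x∈W｛x｝ x)

  ¬reflexive⇒irreflexive-singleton : ExcludedMiddle a →
    {W : Operator L} → Monotonic W → ¬ Reflexive W →
    Σ L λ x → x ∉ W ｛ x ｝
  ¬reflexive⇒irreflexive-singleton em mono ¬refl =
    em⇒dne em λ none → ¬refl (reflexive-on-singletons⇒reflexive mono
      λ x → em⇒dne em λ x∉ → none (x , x∉))

mainTheorem15 : (em : ∀ {ℓ} → ExcludedMiddle ℓ) → ∀ {a : Level} (L : Set a) (W : Operator L)
    → Monotonic W → ¬ Reflexive W → IsSType (Lift a (Fin 1)) W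
mainTheorem15 em L W mono ¬refl
  with x , x∉W｛x｝ ← ¬reflexive⇒irreflexive-singleton em mono ¬refl =
  mono , SingletonsOf x ,
  singletonsOf-internally-One x , singletonsOf-antiReflexive mono x∉W｛x｝
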